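{- Let $T$ be a commutative monad on a cartesian monoidal category $\mathbb C$ and $X$ an object. The family of Kleisli morphisms $(\mathsf{samp}_n:TX\rightsquigarrow X^{\otimes n})_{n\in\mathbb N}$ is jointly monic in $\mathsf{Kl}(T)$ if and only if the family of morphisms $$TTX\xrightarrow{T(\Delta_n)}T((TX)^n)\xrightarrow{T(\nabla_n)}TT(X^n)\xrightarrow{\mu_{X^n}}T(X^n),\qquad n\in\mathbb N,$$ is jointly monic in $\mathbb C$.
   Context: Kleisli morphisms $f:A\rightsquigarrow B$ correspond to $f^\sharp:A\to TB$, composition $(g\circledcirc f)^\sharp=\mu\circ Tg^\sharp\circ f^\sharp$. $T$ commutative means it has a symmetric monoidal structure $\nabla_{A,B}:TA\times TB\to T(A\times B)$ (with $\eta_1:1\to T1$), and $\nabla_n:(TX)^n\to T(X^n)$ denotes the $n$-ary iterate ($\nabla_0=\eta_1$, $\nabla_1=1$). $\Delta_n:TX\to (TX)^n$ is the $n$-fold diagonal. $\mathsf{Kl}(T)$ is monoidal with $A\otimes B=A\times B$, $(f\otimes g)^\sharp=\nabla\circ(f^\sharp\times g^\sharp)$, and copy-discard structure $(\mathsf{copy}_X)^\sharp=\eta\circ\Delta$, $(\mathsf{del}_X)^\sharp=\eta\circ !$. $\mathsf{copy}_n:Y\rightsquigarrow Y^{\otimes n}$ is the iterated copy map ($\mathsf{copy}_0=\mathsf{del}$, $\mathsf{copy}_1=1$). $\mathsf{force}_X:TX\rightsquigarrow X$ has $(\mathsf{force}_X)^\sharp=1_{TX}$. $\mathsf{samp}_n=\mathsf{force}^{\otimes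 n}\circledcirc\mathsf{copy}_n:TX\rightsquigarrow X^{\otimes n}$. A family $(g_n:Y\to Z_n)$ is jointly monic if $g_n\circ a=g_n\circ b$ for all $n$ implies $a=b$. -}

module Defs where

open import Level using (Level; _⊔_) renaming (suc to lsuc)
open import Data.Nat using (ℕ; zero; suc)
open import Relation.Binary.PropositionalEquality using (_≡_)

record Category (o ℓ : Level) : Set (lsuc (o ⊔ ℓ)) where
  infixr 9 _∘_
  field
    Obj  : Set o
    Hom  : Obj → Obj → Set ℓ
    id   : ∀ {A} → Hom A A
    _∘_  : ∀ {A B C} → Hom B C → Hom A B → Hom A C
    identityˡ : ∀ {A B} {f : Hom A B} → id ∘ f ≡ f
    identityʳ : ∀ {A B} {f : Hom A B} → f ∘ id ≡ f
    assoc     : ∀ {A B C D} {f : Hom A B} {g : Hom B C} {h : Hom C D} →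
                (h ∘ g) ∘ f ≡ h ∘ (g ∘ f)

record Cartesian {o ℓ : Level} (C : Category o ℓ) : Set (o ⊔ ℓ) where
  open Category C
  infixr 7 _×_
  field
    ⊤      : Obj
    !      : ∀ {A} → Hom A ⊤
    !-unique : ∀ {A} (f : Hom A ⊤) → f ≡ !
    _×_    : Obj → Obj → Obj
    π₁     : ∀ {A B} → Hom (A × B) A
    π₂     : ∀ {A B} → Hom (A × B) B
    ⟨_,_⟩  : ∀ {A B Z} → Hom Z A → Hom Z B → Hom Z (A × B)
    project₁ : ∀ {A B Z} {f : Hom Z A} {g : Hom Z B} → π₁ ∘ ⟨ f , g ⟩ ≡ f
    project₂ : ∀ {A B Z} {f : Hom Z A} {g : Hom Z B} → π₂ ∘ ⟨ f , g ⟩ ≡ g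
    unique   : ∀ {A B Z} {f : Hom Z A} {g : Hom Z B} {h : Hom Z (A × B)} →
               π₁ ∘ h ≡ f → π₂ ∘ h ≡ g → ⟨ f , g ⟩ ≡ h

  infixr 8 _⁂_
  _⁂_ : ∀ {A B A' B'} → Hom A A' → Hom B B' → Hom (A × B) (A' × B')
  f ⁂ g = ⟨ f ∘ π₁ , g ∘ π₂ ⟩

  Δ : ∀ {A} → Hom A (A × A)
  Δ = ⟨ id , id ⟩

  assocʳ : ∀ {A B D} → Hom ((A × B) × D) (A × (B × D))
  assocʳ = ⟨ π₁ ∘ π₁ , ⟨ π₂ ∘ π₁ , π₂ ⟩ ⟩

  swap : ∀ {A B} → Hom (A × B) (B × A)
  swap = ⟨ π₂ , π₁ ⟩

  pow : Obj → ℕ → Obj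
  pow A zero = ⊤
  pow A (suc zero) = A
  pow A (suc (suc n)) = A × pow A (suc n)

  Δₙ : ∀ {A} (n : ℕ) → Hom A (pow A n)
  Δₙ zero = !
  Δₙ (suc zero) = id
  Δₙ (suc (suc n)) = ⟨ id , Δₙ (suc n) ⟩

record Monad {o ℓ : Level} (C : Category o ℓ) : Set (o ⊔ ℓ) where
  open Category C
  field
    F₀ : Obj → Obj
    F₁ : ∀ {A B} → Hom A B → Hom (F₀ A) (F₀ B)
    F-id : ∀ {A} → F₁ (id {A}) ≡ id
    F-∘  : ∀ {A B D} {f : Hom A B} {g : Hom B D} → F₁ (g ∘ f) ≡ F₁ g ∘ F₁ f
    η : ∀ {A} → Hom A (F₀ A)
    μ : ∀ {A} → Hom (F₀ (F₀ A)) (F₀ A)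
    η-natural : ∀ {A B} {f : Hom A B} → F₁ f ∘ η ≡ η ∘ f
    μ-natural : ∀ {A B} {f : Hom A B} → F₁ f ∘ μ ≡ μ ∘ F₁ (F₁ f)
    μ-assoc   : ∀ {A} → μ {A} ∘ F₁ μ ≡ μ ∘ μ
    μ-unitˡ   : ∀ {A} → μ {A} ∘ F₁ η ≡ id
    μ-unitʳ   : ∀ {A} → μ {A} ∘ η ≡ id

-- T commutative: a symmetric monoidal monad structure
-- ∇_{A,B} : TA × TB → T(A × B) with unit η_⊤ : ⊤ → T⊤
-- (lax symmetric monoidal functor such that η and μ are monoidal).
record Commutative {o ℓ : Level} (C : Category o ℓ) (K : Cartesian C)
                   (T : Monad C) : Set (o ⊔ ℓ) where
  open Category C
  open Cartesian K
  open Monad T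
  field
    ∇ : ∀ {A B} → Hom (F₀ A × F₀ B) (F₀ (A × B))
    ∇-natural : ∀ {A B A' B'} {f : Hom A A'} {g : Hom B B'} →
                ∇ ∘ (F₁ f ⁂ F₁ g) ≡ F₁ (f ⁂ g) ∘ ∇
    ∇-assoc : ∀ {A B D} →
              F₁ (assocʳ {A} {B} {D}) ∘ ∇ ∘ (∇ ⁂ id) ≡ ∇ ∘ (id ⁂ ∇) ∘ assocʳ
    ∇-unitˡ : ∀ {A} → F₁ (π₂ {⊤} {A}) ∘ ∇ ∘ (η ⁂ id) ≡ π₂
    ∇-unitʳ : ∀ {A} → F₁ (π₁ {A} {⊤}) ∘ ∇ ∘ (id ⁂ η) ≡ π₁
    ∇-symm  : ∀ {A B} → F₁ (swap {A} {B}) ∘ ∇ ≡ ∇ ∘ swap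
    ∇-η : ∀ {A B} → ∇ ∘ (η ⁂ η) ≡ η {A × B}
    ∇-μ : ∀ {A B} → μ {A × B} ∘ F₁ ∇ ∘ ∇ ≡ ∇ ∘ (μ ⁂ μ)

module KleisliNotions {o ℓ : Level} (C : Category o ℓ) (K : Cartesian C)
                      (T : Monad C) (Tc : Commutative C K T) where
  open Category C
  open Cartesian K
  open Monad T
  open Commutative Tc

  -- Kleisli morphisms A ⇝ B are represented by their transposes f♯ : A → TB.
  _⇝_ : Obj → Obj → Set ℓ
  A ⇝ B = Hom A (F₀ B)

  idₖ : ∀ {A} → A ⇝ A
  idₖ = η

  infixr 9 _⊚_
  _⊚_ : ∀ {A B D} → B ⇝ D → A ⇝ B → A ⇝ D
  g ⊚ f = μ ∘ F₁ g ∘ f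

  infixr 8 _⊗_
  _⊗_ : ∀ {A B A' B'} → A ⇝ A' → B ⇝ B' → (A × B) ⇝ (A' × B')
  f ⊗ g = ∇ ∘ (f ⁂ g)

  copy : ∀ {A} → A ⇝ (A × A)
  copy = η ∘ Δ

  del : ∀ {A} → A ⇝ ⊤
  del = η ∘ !

  force : ∀ {A} → F₀ A ⇝ A
  force = id

  copyₙ : ∀ {A} (n : ℕ) → A ⇝ pow A n
  copyₙ zero = del
  copyₙ (suc zero) = idₖ
  copyₙ (suc (suc n)) = (idₖ ⊗ copyₙ (suc n)) ⊚ copy

  tensorPow : ∀ {A B} (n : ℕ) → A ⇝ B → pow A n ⇝ pow B n
  tensorPow zero f = idₖ
  tensorPow (suc zero) f = f
  tensorPow (suc (suc n)) f = f ⊗ tensorPow (suc n) f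

  samp : ∀ {A} (n : ℕ) → F₀ A ⇝ pow A n
  samp n = tensorPow n force ⊚ copyₙ n

  ∇ₙ : ∀ {A} (n : ℕ) → Hom (pow (F₀ A) n) (F₀ (pow A n))
  ∇ₙ zero = η
  ∇ₙ (suc zero) = id
  ∇ₙ (suc (suc n)) = ∇ ∘ (id ⁂ ∇ₙ (suc n))

  diagMap : ∀ {A} (n : ℕ) → Hom (F₀ (F₀ A)) (F₀ (pow A n))
  diagMap n = μ ∘ F₁ (∇ₙ n) ∘ F₁ (Δₙ n)

  JointlyMonic : ∀ {Y} {Z : ℕ → Obj} → ((n : ℕ) → Hom Y (Z n)) → Set (o ⊔ ℓ)
  JointlyMonic {Y} g = ∀ {W} (a b : Hom W Y) → (∀ n → g n ∘ a ≡ g n ∘ b) → a ≡ b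

  JointlyMonicKl : ∀ {Y} {Z : ℕ → Obj} → ((n : ℕ) → Y ⇝ Z n) → Set (o ⊔ ℓ)
  JointlyMonicKl {Y} g = ∀ {W} (a b : W ⇝ Y) → (∀ n → g n ⊚ a ≡ g n ⊚ b) → a ≡ b

{-# OPTIONS --safe #-}
-- A Kleisli morphism W ⇝ TX is a C-morphism W → TTX, and Kleisli
-- postcomposition with g is C-postcomposition with its extension μ ∘ T g.
-- Hence joint monicity of (samp n) in Kl(T) is joint monicity of
-- (μ ∘ T samp n) in C, and it remains to see samp n = ∇ₙ ∘ Δₙ: by induction
-- on n, the key point being the interchange law of ⊗ with Kleisli
-- composition, which is where commutativity (∇ compatible with μ) enters.
module Submission where

open import Defs
open import Level using (Level)
open import Function.Bundles using (_⇔_; mk⇔)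
open import Data.Nat using (ℕ; zero; suc)
open import Relation.Binary.PropositionalEquality
  using (_≡_; refl; sym; trans; cong; cong₂; module ≡-Reasoning)

module CartesianProperties {o ℓ : Level} {C : Category o ℓ} (K : Cartesian C) where
  open Category C
  open Cartesian K

  ⟨⟩∘ : ∀ {A B Z W} {f : Hom Z A} {g : Hom Z B} {h : Hom W Z} →
        ⟨ f , g ⟩ ∘ h ≡ ⟨ f ∘ h , g ∘ h ⟩
  ⟨⟩∘ {h = h} = sym (unique (trans (sym assoc) (cong (_∘ h) project₁))
                            (trans (sym assoc) (cong (_∘ h) project₂)))

  ⁂∘⟨⟩ : ∀ {A B A' B' Z} {f : Hom A A'} {g : Hom B B'} {h : Hom Z A} {k : Hom Z B} →
         (f ⁂ g) ∘ ⟨ h , k ⟩ ≡ ⟨ f ∘ h , g ∘ k ⟩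
  ⁂∘⟨⟩ {f = f} {g} = trans ⟨⟩∘ (cong₂ ⟨_,_⟩ (trans assoc (cong (f ∘_) project₁))
                                            (trans assoc (cong (g ∘_) project₂)))

  ⁂∘⁂ : ∀ {A B A' B' A'' B''} {f : Hom A' A''} {g : Hom B' B''}
          {f' : Hom A A'} {g' : Hom B B'} →
        (f ⁂ g) ∘ (f' ⁂ g') ≡ (f ∘ f') ⁂ (g ∘ g')
  ⁂∘⁂ = trans ⁂∘⟨⟩ (cong₂ ⟨_,_⟩ (sym assoc) (sym assoc))

  ⁂-∘-Δ : ∀ {A A' B B'} {f : Hom A A'} {g : Hom B B'} {h : Hom A B} →
          (f ⁂ (g ∘ h)) ∘ Δ ≡ (f ⁂ g) ∘ ⟨ id , h ⟩
  ⁂-∘-Δ = trans ⁂∘⟨⟩ (trans (cong₂ ⟨_,_⟩ refl identityʳ) (sym ⁂∘⟨⟩))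

module KleisliProperties {o ℓ : Level} (C : Category o ℓ) (K : Cartesian C)
                         (T : Monad C) (Tc : Commutative C K T) where
  open Category C
  open Cartesian K
  open Monad T
  open Commutative Tc
  open KleisliNotions C K T Tc
  open CartesianProperties K
  open ≡-Reasoning

  extend : ∀ {A B} → A ⇝ B → Hom (F₀ A) (F₀ B)
  extend g = μ ∘ F₁ g

  ⊚-as-extend : ∀ {A B D} {g : B ⇝ D} {f : A ⇝ B} → g ⊚ f ≡ extend g ∘ f
  ⊚-as-extend = sym assoc

  ⊚-∘ : ∀ {A A' B D} {g : B ⇝ D} {f : A ⇝ B} {h : Hom A' A} → g ⊚ (f ∘ h) ≡ (g ⊚ f) ∘ h
  ⊚-∘ = trans (cong (μ ∘_) (sym assoc)) (sym assoc)

  ⊚-identityʳ : ∀ {A B} {f : A ⇝ B} → f ⊚ idₖ ≡ f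
  ⊚-identityʳ {f = f} = begin
    μ ∘ F₁ f ∘ η   ≡⟨ cong (μ ∘_) η-natural ⟩
    μ ∘ η ∘ f      ≡⟨ sym assoc ⟩
    (μ ∘ η) ∘ f    ≡⟨ cong (_∘ f) μ-unitʳ ⟩
    id ∘ f         ≡⟨ identityˡ ⟩
    f              ∎

  ⊚-pure : ∀ {A B D} {f : B ⇝ D} {h : Hom A B} → f ⊚ (η ∘ h) ≡ f ∘ h
  ⊚-pure {h = h} = trans ⊚-∘ (cong (_∘ h) ⊚-identityʳ)

  ⊗-interchange : ∀ {A B A' B' A'' B''} {f : A' ⇝ A''} {g : B' ⇝ B''}
                    {f' : A ⇝ A'} {g' : B ⇝ B'} →
                  (f ⊗ g) ⊚ (f' ⊗ g') ≡ (f ⊚ f') ⊗ (g ⊚ g')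
  ⊗-interchange {f = f} {g} {f'} {g'} = begin
    μ ∘ F₁ (∇ ∘ (f ⁂ g)) ∘ ∇ ∘ (f' ⁂ g')
      ≡⟨ cong (λ z → μ ∘ z ∘ ∇ ∘ (f' ⁂ g')) F-∘ ⟩
    μ ∘ (F₁ ∇ ∘ F₁ (f ⁂ g)) ∘ ∇ ∘ (f' ⁂ g')
      ≡⟨ cong (μ ∘_) (trans assoc (cong (F₁ ∇ ∘_) (sym assoc))) ⟩
    μ ∘ F₁ ∇ ∘ (F₁ (f ⁂ g) ∘ ∇) ∘ (f' ⁂ g')
      ≡⟨ cong (λ z → μ ∘ F₁ ∇ ∘ z ∘ (f' ⁂ g')) (sym ∇-natural) ⟩
    μ ∘ F₁ ∇ ∘ (∇ ∘ (F₁ f ⁂ F₁ g)) ∘ (f' ⁂ g')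
      ≡⟨ trans (cong (λ z → μ ∘ F₁ ∇ ∘ z) assoc) (sym (trans assoc assoc)) ⟩
    ((μ ∘ F₁ ∇) ∘ ∇) ∘ (F₁ f ⁂ F₁ g) ∘ (f' ⁂ g')
      ≡⟨ cong (_∘ ((F₁ f ⁂ F₁ g) ∘ (f' ⁂ g'))) (trans assoc ∇-μ) ⟩
    (∇ ∘ (μ ⁂ μ)) ∘ (F₁ f ⁂ F₁ g) ∘ (f' ⁂ g')
      ≡⟨ trans assoc (cong (∇ ∘_) (trans (cong ((μ ⁂ μ) ∘_) ⁂∘⁂) ⁂∘⁂)) ⟩
    ∇ ∘ ((μ ∘ F₁ f ∘ f') ⁂ (μ ∘ F₁ g ∘ g'))
      ∎

  samp≡∇ₙ∘Δₙ : ∀ {A} (n : ℕ) → samp {A} n ≡ ∇ₙ n ∘ Δₙ n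
  samp≡∇ₙ∘Δₙ zero = ⊚-pure
  samp≡∇ₙ∘Δₙ (suc zero) = trans ⊚-identityʳ (sym identityˡ)
  samp≡∇ₙ∘Δₙ (suc (suc m)) = begin
    (force ⊗ forces) ⊚ (idₖ ⊗ copies) ⊚ (η ∘ Δ)
      ≡⟨ trans (cong ((force ⊗ forces) ⊚_) ⊚-pure) ⊚-∘ ⟩
    ((force ⊗ forces) ⊚ (idₖ ⊗ copies)) ∘ Δ
      ≡⟨ cong (_∘ Δ) ⊗-interchange ⟩
    ((force ⊚ idₖ) ⊗ samp (suc m)) ∘ Δ
      ≡⟨ cong (λ z → (z ⊗ samp (suc m)) ∘ Δ) ⊚-identityʳ ⟩
    (id ⊗ samp (suc m)) ∘ Δ
      ≡⟨ cong (λ z → (id ⊗ z) ∘ Δ) (samp≡∇ₙ∘Δₙ (suc m)) ⟩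
    (∇ ∘ (id ⁂ (∇ₙ (suc m) ∘ Δₙ (suc m)))) ∘ Δ
      ≡⟨ trans assoc (cong (∇ ∘_) ⁂-∘-Δ) ⟩
    ∇ ∘ (id ⁂ ∇ₙ (suc m)) ∘ ⟨ id , Δₙ (suc m) ⟩
      ≡⟨ sym assoc ⟩
    ∇ₙ (suc (suc m)) ∘ Δₙ (suc (suc m))
      ∎
    where
      forces = tensorPow (suc m) force
      copies = copyₙ (suc m)

  extend-samp : ∀ {A} (n : ℕ) → extend (samp {A} n) ≡ diagMap n
  extend-samp n = cong (μ ∘_) (trans (cong F₁ (samp≡∇ₙ∘Δₙ n)) F-∘)

  jointlyMonicKl⇔jointlyMonic-extend :
    ∀ {Y} {Z : ℕ → Obj} (g : (n : ℕ) → Y ⇝ Z n) (h : (n : ℕ) → Hom (F₀ Y) (F₀ (Z n))) →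
    (∀ n → extend (g n) ≡ h n) → JointlyMonicKl g ⇔ JointlyMonic h
  jointlyMonicKl⇔jointlyMonic-extend {Y} g h g*≡h = mk⇔
    (λ mono {_} a b e → mono a b (λ n → trans (⊚≡h∘ n a) (trans (e n) (sym (⊚≡h∘ n b)))))
    (λ mono {_} a b e → mono a b (λ n → trans (sym (⊚≡h∘ n a)) (trans (e n) (⊚≡h∘ n b))))
    where
      ⊚≡h∘ : ∀ {W} n (a : Hom W (F₀ Y)) → g n ⊚ a ≡ h n ∘ a
      ⊚≡h∘ n a = trans ⊚-as-extend (cong (_∘ a) (g*≡h n))

proposition6p3 : ∀ {o ℓ : Level} (C : Category o ℓ) (K : Cartesian C)
                   (T : Monad C) (Tc : Commutative C K T) (X : Category.Obj C) →
                   KleisliNotions.JointlyMonicKl C K T Tc (KleisliNotions.samp C K T Tc {X})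
                   ⇔ KleisliNotions.JointlyMonic C K T Tc (KleisliNotions.diagMap C K T Tc {X})
proposition6p3 C K T Tc X =
  jointlyMonicKl⇔jointlyMonic-extend (samp {X}) diagMap extend-samp
  where open KleisliNotions C K T Tc
        open KleisliProperties C K T Tc
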